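{- For every pair of integers $k \ge 1$ and $\ell \ge 2$, we have $\chi'_{st}(C_{4k} \,\square\, C_{2\ell}) = 6$.
   Context: A star edge-coloring of a graph $G$ is a proper edge-coloring of $G$ in which there is no bichromatic path and no bichromatic cycle of length four (i.e., with four edges). The star chromatic index $\chi'_{st}(G)$ is the minimum number of colors in a star edge-coloring of $G$. $C_m$ denotes the cycle on $m$ vertices. $G \,\square\, H$ denotes the Cartesian product: vertex set $V(G)\times V(H)$, with $(u,v)(u',v')$ an edge iff either $uu'\in E(G)$ and $v=v'$, or $u=u'$ and $vv'\in E(H)$. -}

module Defs where

open import Data.Nat using (ℕ; suc; _+_; _%_; _≤_)
open import Data.Fin using (Fin; toℕ)
open import Data.Product using (_×_; _,_; Σ; ∃; ∃-syntax)
open import Data.Sum using (_⊎_)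
open import Relation.Binary.PropositionalEquality using (_≡_; _≢_)
open import Relation.Nullary using (¬_)
open import Level using (0ℓ) renaming (suc to lsuc)

record Graph : Set₁ where
  field
    V   : Set
    Adj : V → V → Set

open Graph public

CycleAdj : (m : ℕ) → Fin m → Fin m → Set
CycleAdj m i j = (toℕ j ≡ (toℕ i + 1) % suc (m Data.Nat.∸ 1)) ⊎ (toℕ i ≡ (toℕ j + 1) % suc (m Data.Nat.∸ 1))

Cycle : ℕ → Graph
Cycle m = record { V = Fin m ; Adj = CycleAdj m }

_□_ : Graph → Graph → Graph
G □ H = record
  { V   = V G × V H
  ; Adj = λ { (u , v) (u' , v') → (Adj G u u' × v ≡ v') ⊎ (u ≡ u' × Adj H v v') }
  }

-- An edge colouring with colours Fin m: a colour for each pair of vertices,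
-- required symmetric on edges (so it is a function of the unordered edge).
-- Only its values on edges matter.
record EdgeColouring (G : Graph) (m : ℕ) : Set where
  field
    col : V G → V G → Fin m
    sym : ∀ u v → Adj G u v → col u v ≡ col v u

open EdgeColouring public

Proper : {G : Graph} {m : ℕ} → EdgeColouring G m → Set
Proper {G} c = ∀ u v w → Adj G u v → Adj G u w → v ≢ w → col c u v ≢ col c u w

Bichromatic4 : {m : ℕ} → Fin m → Fin m → Fin m → Fin m → Set
Bichromatic4 {m} x₁ x₂ x₃ x₄ =
  ∃[ a ] ∃[ b ] ((x₁ ≡ a ⊎ x₁ ≡ b) × (x₂ ≡ a ⊎ x₂ ≡ b) × (x₃ ≡ a ⊎ x₃ ≡ b) × (x₄ ≡ a ⊎ x₄ ≡ b))

BichromaticPath4 : {G : Graph} {m : ℕ} → EdgeColouring G m → Set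
BichromaticPath4 {G} c =
  Σ (V G) λ v₀ → Σ (V G) λ v₁ → Σ (V G) λ v₂ → Σ (V G) λ v₃ → Σ (V G) λ v₄ →
    (v₀ ≢ v₁ × v₀ ≢ v₂ × v₀ ≢ v₃ × v₀ ≢ v₄ × v₁ ≢ v₂ × v₁ ≢ v₃ × v₁ ≢ v₄ ×
     v₂ ≢ v₃ × v₂ ≢ v₄ × v₃ ≢ v₄) ×
    (Adj G v₀ v₁ × Adj G v₁ v₂ × Adj G v₂ v₃ × Adj G v₃ v₄) ×
    Bichromatic4 (col c v₀ v₁) (col c v₁ v₂) (col c v₂ v₃) (col c v₃ v₄)

BichromaticCycle4 : {G : Graph} {m : ℕ} → EdgeColouring G m → Set
BichromaticCycle4 {G} c =
  Σ (V G) λ v₀ → Σ (V G) λ v₁ → Σ (V G) λ v₂ → Σ (V G) λ v₃ →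
    (v₀ ≢ v₁ × v₀ ≢ v₂ × v₀ ≢ v₃ × v₁ ≢ v₂ × v₁ ≢ v₃ × v₂ ≢ v₃) ×
    (Adj G v₀ v₁ × Adj G v₁ v₂ × Adj G v₂ v₃ × Adj G v₃ v₀) ×
    Bichromatic4 (col c v₀ v₁) (col c v₁ v₂) (col c v₂ v₃) (col c v₃ v₀)

IsStarEdgeColouring : {G : Graph} {m : ℕ} → EdgeColouring G m → Set
IsStarEdgeColouring c = Proper c × ¬ BichromaticPath4 c × ¬ BichromaticCycle4 c

StarColourable : Graph → ℕ → Set
StarColourable G m = Σ (EdgeColouring G m) IsStarEdgeColouring

StarChromaticIndex≡ : Graph → ℕ → Set
StarChromaticIndex≡ G k = StarColourable G k × (∀ m → StarColourable G m → k ≤ m)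

-- Let v be a vertex of a 4-regular graph with a star edge-colouring, and x, y two of its
-- neighbours.  If x had an edge of the colour of vy and y an edge of the colour of vx, these edges together
-- with x v y would form a bichromatic path or 4-cycle; so one of x, y misses the colour of the edge from v
-- to the other.  Sending (v, {x, y}) to that vertex together with its edge back to v maps V × 6 to V × 4,
-- and with at most 5 colours the map is injective: the image determines v and the chosen neighbour, and a
-- vertex seeing 4 distinct colours misses at most one of 5, which determines the other neighbour.
--
-- Colour the torus so that the colour of an edge depends only on its column modulo 4 and
-- on the type of its row, the row types running cyclically through 0 1 2 3 and, when 2ℓ ≡ 2 (mod 4),
-- once through the extra block 4 … 9.  A walk of length 4 sees at most 9 consecutive rows, so the star
-- property reduces to a finite check over all windows of 9 consecutive row types, done by evaluation.

module Submission where

open import Defs renaming (sym to col-sym)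
open import Data.Empty using (⊥; ⊥-elim)
open import Data.Fin using (Fin; zero; suc; toℕ; fromℕ; _↑ˡ_; _↑ʳ_)
open import Data.Fin.Patterns
open import Data.Fin.Properties
  using (_≟_; any?; all?; toℕ-injective; toℕ<n; toℕ-fromℕ<; toℕ-fromℕ; injective⇒≤; *↔×)
open import Data.List using (List; []; _∷_)
open import Data.List.Membership.Propositional using (_∈_)
open import Data.List.Membership.DecPropositional (_≟_ {10}) using (_∈?_)
open import Data.List.Relation.Unary.Any using (here; there)
open import Data.Nat as ℕ using (ℕ; zero; suc; _+_; _*_; _≤_; _<_; s≤s; NonZero)
import Data.Nat.Properties as ℕ
open import Data.Nat.DivMod
  using (_%_; _mod_; m%n<n; %-distribˡ-+; m%n%n≡m%n; [m+n]%n≡m%n; m<n⇒m%n≡m; n%n≡0; %-pred-≡0; m*n%n≡0)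
open import Data.Product using (Σ-syntax; ∃-syntax; _×_; _,_; proj₁; proj₂; uncurry)
open import Data.Product.Function.NonDependent.Propositional using (_×-↔_)
open import Data.Product.Properties using (≡-dec)
open import Data.Sum using (_⊎_; inj₁; inj₂)
import Data.Sum as Sum
open import Data.Vec using (Vec; []; _∷_; tabulate)
import Data.Vec.Functional as Vector
open import Function.Base using (_∘_)
open import Function.Bundles using (_↔_; _↣_; mk↣; Injection)
open import Function.Construct.Composition using (_↣-∘_; _↔-∘_)
open import Function.Definitions using (Injective)
open import Function.Properties.Inverse using (↔-sym; ↔-refl; ↔⇒↣)
open import Relation.Binary.Definitions using (Symmetric; DecidableEquality)
open import Relation.Binary.PropositionalEquality
open import Relation.Nullary using (¬_; Dec; yes; no)
open import Relation.Nullary.Decidable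
  using (decidable-stable; ¬¬-excluded-middle; from-yes; ¬?; _×-dec_; _→-dec_; map′)

-- Cyclic successor on Fin (suc n)

toℕ-mod : ∀ t d .{{_ : NonZero d}} → toℕ (t mod d) ≡ t % d
toℕ-mod t d = toℕ-fromℕ< (m%n<n t d)

[m%d+k]%d≡[m+k]%d : ∀ m k d .{{_ : NonZero d}} → (m % d + k) % d ≡ (m + k) % d
[m%d+k]%d≡[m+k]%d m k d = begin
  (m % d + k) % d           ≡⟨ %-distribˡ-+ (m % d) k d ⟩
  (m % d % d + k % d) % d   ≡⟨ cong (λ x → (x + k % d) % d) (m%n%n≡m%n m d) ⟩
  (m % d + k % d) % d       ≡⟨ %-distribˡ-+ m k d ⟨
  (m + k) % d               ∎
  where open ≡-Reasoning

next prev : ∀ {n} → Fin (suc n) → Fin (suc n)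
next {n} i = (toℕ i + 1) mod suc n
prev {n} i = (toℕ i + n) mod suc n

module _ {n : ℕ} where

  mod-+ : ∀ t k → (toℕ (t mod suc n) + k) mod suc n ≡ (t + k) mod suc n
  mod-+ t k = toℕ-injective (begin
    toℕ ((toℕ (t mod suc n) + k) mod suc n) ≡⟨ toℕ-mod (toℕ (t mod suc n) + k) (suc n) ⟩
    (toℕ (t mod suc n) + k) % suc n         ≡⟨ cong (λ x → (x + k) % suc n) (toℕ-mod t (suc n)) ⟩
    (t % suc n + k) % suc n                 ≡⟨ [m%d+k]%d≡[m+k]%d t k (suc n) ⟩
    (t + k) % suc n                         ≡⟨ toℕ-mod (t + k) (suc n) ⟨
    toℕ ((t + k) mod suc n)                 ∎)
    where open ≡-Reasoning

  full-turn : ∀ (i : Fin (suc n)) → (toℕ i + suc n) mod suc n ≡ i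
  full-turn i = toℕ-injective (begin
    toℕ ((toℕ i + suc n) mod suc n) ≡⟨ toℕ-mod (toℕ i + suc n) (suc n) ⟩
    (toℕ i + suc n) % suc n         ≡⟨ [m+n]%n≡m%n (toℕ i) (suc n) ⟩
    toℕ i % suc n                   ≡⟨ m<n⇒m%n≡m (toℕ<n i) ⟩
    toℕ i                           ∎)
    where open ≡-Reasoning

  next-prev : ∀ (i : Fin (suc n)) → next (prev i) ≡ i
  next-prev i = begin
    next (prev i)               ≡⟨ mod-+ (toℕ i + n) 1 ⟩
    (toℕ i + n + 1) mod suc n   ≡⟨ cong (_mod suc n) (ℕ.+-assoc (toℕ i) n 1) ⟩
    (toℕ i + (n + 1)) mod suc n ≡⟨ cong (λ k → (toℕ i + k) mod suc n) (ℕ.+-comm n 1) ⟩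
    (toℕ i + suc n) mod suc n   ≡⟨ full-turn i ⟩
    i                           ∎
    where open ≡-Reasoning

  prev-next : ∀ (i : Fin (suc n)) → prev (next i) ≡ i
  prev-next i = begin
    prev (next i)               ≡⟨ mod-+ (toℕ i + 1) n ⟩
    (toℕ i + 1 + n) mod suc n   ≡⟨ cong (_mod suc n) (ℕ.+-assoc (toℕ i) 1 n) ⟩
    (toℕ i + suc n) mod suc n   ≡⟨ full-turn i ⟩
    i                           ∎
    where open ≡-Reasoning

  next-mod : ∀ t → next (t mod suc n) ≡ suc t mod suc n
  next-mod t = trans (mod-+ t 1) (cong (_mod suc n) (ℕ.+-comm t 1))

  toℕ-next : ∀ (i : Fin (suc n)) → toℕ (next i) ≡ (toℕ i + 1) % suc n
  toℕ-next i = toℕ-mod (toℕ i + 1) (suc n)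

  next-view : ∀ (i : Fin (suc n)) → toℕ (next i) ≡ suc (toℕ i) ⊎ (toℕ i ≡ n × toℕ (next i) ≡ 0)
  next-view i with ℕ.m≤n⇒m<n∨m≡n (ℕ.s≤s⁻¹ (toℕ<n i))
  ... | inj₁ i<n = inj₁ (begin
    toℕ (next i)        ≡⟨ toℕ-next i ⟩
    (toℕ i + 1) % suc n ≡⟨ cong (_% suc n) (ℕ.+-comm (toℕ i) 1) ⟩
    suc (toℕ i) % suc n ≡⟨ m<n⇒m%n≡m (s≤s i<n) ⟩
    suc (toℕ i)         ∎)
    where open ≡-Reasoning
  ... | inj₂ i≡n = inj₂ (i≡n , (begin
    toℕ (next i)        ≡⟨ toℕ-next i ⟩
    (toℕ i + 1) % suc n ≡⟨ cong (λ x → (x + 1) % suc n) i≡n ⟩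
    (n + 1) % suc n     ≡⟨ cong (_% suc n) (ℕ.+-comm n 1) ⟩
    suc n % suc n       ≡⟨ n%n≡0 (suc n) ⟩
    0                   ∎))
    where open ≡-Reasoning

  next≢ : 1 ≤ n → ∀ {i : Fin (suc n)} → next i ≢ i
  next≢ 1≤n {i} eq with next-view i
  ... | inj₁ p = ℕ.1+n≢n (trans (sym p) (cong toℕ eq))
  ... | inj₂ (i≡n , p) = ℕ.<⇒≢ 1≤n (trans (sym p) (trans (cong toℕ eq) i≡n))

  next∘next≢ : 2 ≤ n → ∀ {i : Fin (suc n)} → next (next i) ≢ i
  next∘next≢ 2≤n {i} eq with next-view i | next-view (next i)
  ... | inj₁ p | inj₁ q = ℕ.m≢1+n+m (toℕ i) (trans (cong toℕ (sym eq)) (trans q (cong suc p)))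
  ... | inj₁ p | inj₂ (q , r) = ℕ.<⇒≢ 2≤n (trans (cong suc (trans (sym r) (cong toℕ eq))) (trans (sym p) q))
  ... | inj₂ (p , q) | inj₁ r = ℕ.<⇒≢ 2≤n (trans (trans (cong suc (sym q)) (sym r)) (trans (cong toℕ eq) p))
  ... | inj₂ (p , q) | inj₂ (r , _) = ℕ.<⇒≢ (ℕ.<⇒≤ 2≤n) (trans (sym q) r)

  prev≢ : 1 ≤ n → ∀ {i : Fin (suc n)} → prev i ≢ i
  prev≢ 1≤n {i} eq = next≢ 1≤n (trans (cong next (sym eq)) (next-prev i))

  next≢prev : 2 ≤ n → ∀ {i : Fin (suc n)} → next i ≢ prev i
  next≢prev 2≤n {i} eq = next∘next≢ 2≤n (trans (cong next eq) (next-prev i))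

  cycle-next : ∀ (i : Fin (suc n)) → CycleAdj (suc n) i (next i)
  cycle-next i = inj₁ (toℕ-next i)

  cycle-prev : ∀ (i : Fin (suc n)) → CycleAdj (suc n) i (prev i)
  cycle-prev i = inj₂ (trans (cong toℕ (sym (next-prev i))) (toℕ-next (prev i)))

  cycle-adj : ∀ {i j : Fin (suc n)} → CycleAdj (suc n) i j → j ≡ next i ⊎ j ≡ prev i
  cycle-adj {i} (inj₁ p) = inj₁ (toℕ-injective (trans p (sym (toℕ-next i))))
  cycle-adj {j = j} (inj₂ p) =
    inj₂ (trans (sym (prev-next j)) (cong prev (sym (toℕ-injective (trans p (sym (toℕ-next j)))))))

  cycle-irrefl : 1 ≤ n → ∀ {i : Fin (suc n)} → ¬ CycleAdj (suc n) i i
  cycle-irrefl 1≤n a with cycle-adj a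
  ... | inj₁ i≡next = next≢ 1≤n (sym i≡next)
  ... | inj₂ i≡prev = prev≢ 1≤n (sym i≡prev)

next^ : ∀ {n} → ℕ → Fin (suc n) → Fin (suc n)
next^ zero    i = i
next^ (suc t) i = next (next^ t i)

last-residue : ∀ d t k → suc t ≡ suc d * k → t mod suc d ≡ fromℕ d
last-residue d t k e = toℕ-injective (begin
  toℕ (t mod suc d) ≡⟨ toℕ-mod t (suc d) ⟩
  t % suc d         ≡⟨ %-pred-≡0 (trans (cong (_% suc d) (trans e (ℕ.*-comm (suc d) k))) (m*n%n≡0 k (suc d))) ⟩
  d                 ≡⟨ toℕ-fromℕ d ⟨
  toℕ (fromℕ d)     ∎)
  where open ≡-Reasoning

cyclic-closure : ∀ {A : Set} {n} (R : A → A → Set) (f : ℕ → A) →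
                 (∀ t → R (f t) (f (suc t))) → R (f n) (f 0) →
                 ∀ (j : Fin (suc n)) → R (f (toℕ j)) (f (toℕ (next j)))
cyclic-closure R f step wrap j with next-view j
... | inj₁ p       = subst (λ t → R (f (toℕ j)) (f t)) (sym p) (step (toℕ j))
... | inj₂ (p , q) = subst₂ (λ s t → R (f s) (f t)) (sym p) (sym q) wrap

-- Injections between finite sets

×-↣⇒≤ : ∀ {A : Set} {n p q} → A ↔ Fin n → (A × Fin p) ↣ (A × Fin q) → n * p ≤ n * q
×-↣⇒≤ {A} {n} {p} {q} A↔Fin f =
  injective⇒≤ (Injection.injective (↔⇒↣ (toFin q) ↣-∘ (f ↣-∘ ↔⇒↣ (↔-sym (toFin p)))))
  where
  toFin : ∀ r → (A × Fin r) ↔ Fin (n * r)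
  toFin r = ↔-sym *↔× ↔-∘ (A↔Fin ×-↔ ↔-refl)

∷-injective : ∀ {A : Set} {n} {x : A} {f : Fin n → A} →
              (∀ i → f i ≢ x) → Injective _≡_ _≡_ f → Injective _≡_ _≡_ (x Vector.∷ f)
∷-injective f≢x f-inj {zero}  {zero}  _  = refl
∷-injective f≢x f-inj {zero}  {suc j} eq = ⊥-elim (f≢x j (sym eq))
∷-injective f≢x f-inj {suc i} {zero}  eq = ⊥-elim (f≢x i eq)
∷-injective f≢x f-inj {suc i} {suc j} eq = cong suc (f-inj eq)

-- Star edge-colourings

module StarColouring {G : Graph} (adj-sym : Symmetric (Adj G)) (adj-irrefl : ∀ {u} → ¬ Adj G u u)
                     {m : ℕ} (c : EdgeColouring G m) (star : IsStarEdgeColouring c) where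

  private
    proper : Proper c
    proper = proj₁ star

  ≢-adj : ∀ {u w} → Adj G u w → u ≢ w
  ≢-adj uw refl = adj-irrefl uw

  far-end : ∀ {v x y x′} → Adj G v x → Adj G v y → x ≢ y → Adj G x x′ → col c x x′ ≡ col c v y →
            x′ ≢ v × x′ ≢ y
  far-end {v} {x} {y} vx vy x≢y xx′ eq = (λ { refl → proper v x y vx vy x≢y (trans (col-sym c v x vx) eq) })
    , λ { refl → proper y x v (adj-sym xx′) (adj-sym vy) (≢-adj vx ∘ sym)
                   (trans (sym (col-sym c x y xx′)) (trans eq (col-sym c v y vy))) }

  -- x′ x v y y′ would be a bichromatic path, or a bichromatic 4-cycle when x′ = y′.
  ¬alternating-extension : ∀ {v x y x′ y′} → Adj G v x → Adj G v y → x ≢ y →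
                           Adj G x x′ → Adj G y y′ → col c x x′ ≡ col c v y → col c y y′ ≡ col c v x → ⊥
  ¬alternating-extension {v} {x} {y} {x′} {y′} vx vy x≢y xx′ yy′ α≡ β≡ =
    ¬¬-excluded-middle {A = x′ ≡ y′} λ where
      (yes refl) → proj₂ (proj₂ star)
        (x′ , x , v , y , (x′≢x , x′≢v , x′≢y , x≢v , x≢y , v≢y) , edges , alternation)
      (no x′≢y′) → proj₁ (proj₂ star)
        (x′ , x , v , y , y′ ,
         (x′≢x , x′≢v , x′≢y , x′≢y′ , x≢v , x≢y , y′≢x ∘ sym , v≢y , y′≢v ∘ sym , ≢-adj yy′) ,
         edges , alternation)
    where
    edges : Adj G x′ x × Adj G x v × Adj G v y × Adj G y y′
    edges = adj-sym xx′ , adj-sym vx , vy , yy′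
    alternation : Bichromatic4 (col c x′ x) (col c x v) (col c v y) (col c y y′)
    alternation = col c v x , col c v y , inj₂ (trans (col-sym c x′ x (adj-sym xx′)) α≡) ,
                  inj₁ (sym (col-sym c v x vx)) , inj₂ refl , inj₁ β≡
    x′≢x : x′ ≢ x
    x′≢x = ≢-adj xx′ ∘ sym
    x≢v : x ≢ v
    x≢v = ≢-adj vx ∘ sym
    v≢y : v ≢ y
    v≢y = ≢-adj vy
    x′≢v : x′ ≢ v
    x′≢v = proj₁ (far-end vx vy x≢y xx′ α≡)
    x′≢y : x′ ≢ y
    x′≢y = proj₂ (far-end vx vy x≢y xx′ α≡)
    y′≢v : y′ ≢ v
    y′≢v = proj₁ (far-end vy vx (x≢y ∘ sym) yy′ β≡)
    y′≢x : y′ ≢ x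
    y′≢x = proj₂ (far-end vy vx (x≢y ∘ sym) yy′ β≡)

-- Four-regular graphs

record FourRegular (G : Graph) : Set where
  field
    nbr           : V G → Fin 4 → V G
    adj-nbr       : ∀ u d → Adj G u (nbr u d)
    nbr-of-adj    : ∀ {u v} → Adj G u v → ∃[ d ] v ≡ nbr u d
    nbr-injective : ∀ u → Injective _≡_ _≡_ (nbr u)
    adj-sym       : Symmetric (Adj G)
    adj-irrefl    : ∀ {u} → ¬ Adj G u u

  back : ∀ u d → ∃[ e ] u ≡ nbr (nbr u d) e
  back u d = nbr-of-adj (adj-sym (adj-nbr u d))

-- p : Fin 6 indexes the pair {first p, second p} of directions; pairIndex recovers p in either order.
first second : Fin 6 → Fin 4
first 0F = 0F
first 1F = 0F
first 2F = 0F
first 3F = 1F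
first 4F = 1F
first 5F = 2F
second 0F = 1F
second 1F = 2F
second 2F = 3F
second 3F = 2F
second 4F = 3F
second 5F = 3F

pairIndex : Fin 4 → Fin 4 → Fin 6
pairIndex 0F 1F = 0F
pairIndex 0F 2F = 1F
pairIndex 0F 3F = 2F
pairIndex 1F 2F = 3F
pairIndex 1F 3F = 4F
pairIndex 2F 3F = 5F
pairIndex 1F 0F = 0F
pairIndex 2F 0F = 1F
pairIndex 3F 0F = 2F
pairIndex 2F 1F = 3F
pairIndex 3F 1F = 4F
pairIndex 3F 2F = 5F
pairIndex _  _  = 0F

first≢second : ∀ p → first p ≢ second p
first≢second = from-yes (all? λ p → ¬? (first p ≟ second p))

pairIndex-first-second : ∀ p → pairIndex (first p) (second p) ≡ p
pairIndex-first-second = from-yes (all? λ p → pairIndex (first p) (second p) ≟ p)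

pairIndex-second-first : ∀ p → pairIndex (second p) (first p) ≡ p
pairIndex-second-first = from-yes (all? λ p → pairIndex (second p) (first p) ≟ p)

module LowerBound {G : Graph} (R : FourRegular G) {m : ℕ} (c : EdgeColouring G m) (star : IsStarEdgeColouring c) where
  open FourRegular R
  open StarColouring {G} adj-sym adj-irrefl c star

  colour : V G → Fin 4 → Fin m
  colour v d = col c v (nbr v d)

  colour-injective : ∀ v → Injective _≡_ _≡_ (colour v)
  colour-injective v {d} {d′} eq = decidable-stable (d ≟ d′) λ d≢d′ →
    proj₁ star v _ _ (adj-nbr v d) (adj-nbr v d′) (d≢d′ ∘ nbr-injective v) eq

  Sees : V G → Fin m → Set
  Sees w x = ∃[ e ] colour w e ≡ x

  sees? : ∀ w x → Dec (Sees w x)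
  sees? w x = any? λ e → colour w e ≟ x

  two-unseen⇒6≤m : ∀ {w x y} → x ≢ y → ¬ Sees w x → ¬ Sees w y → 6 ≤ m
  two-unseen⇒6≤m {w} {x} {y} x≢y ¬x ¬y =
    injective⇒≤ (∷-injective x-new (∷-injective y-new (colour-injective w)))
    where
    y-new : ∀ e → colour w e ≢ y
    y-new e eq = ¬y (e , eq)
    x-new : ∀ i → (y Vector.∷ colour w) i ≢ x
    x-new zero    = x≢y ∘ sym
    x-new (suc e) eq = ¬x (e , eq)

  ¬sees-both : ∀ {v d₁ d₂} → d₁ ≢ d₂ →
               Sees (nbr v d₁) (colour v d₂) → Sees (nbr v d₂) (colour v d₁) → ⊥
  ¬sees-both {v} {d₁} {d₂} d₁≢d₂ (e₁ , eq₁) (e₂ , eq₂) =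
    ¬alternating-extension (adj-nbr v d₁) (adj-nbr v d₂) (d₁≢d₂ ∘ nbr-injective v)
      (adj-nbr (nbr v d₁) e₁) (adj-nbr (nbr v d₂) e₂) eq₁ eq₂

  choose : ∀ v p → Σ[ (d , o) ∈ Fin 4 × Fin 4 ] pairIndex d o ≡ p × ¬ Sees (nbr v d) (colour v o)
  choose v p with sees? (nbr v (first p)) (colour v (second p))
  ... | no ¬s = (first p , second p) , pairIndex-first-second p , ¬s
  ... | yes s = (second p , first p) , pairIndex-second-first p , ¬sees-both (first≢second p) s

  root other : V G → Fin 6 → Fin 4
  root v p = proj₁ (proj₁ (choose v p))
  other v p = proj₂ (proj₁ (choose v p))

  witness : V G × Fin 6 → V G × Fin 4
  witness (v , p) = nbr v (root v p) , proj₁ (back v (root v p))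

  witness-centre : ∀ {v v′ p q} → witness (v , p) ≡ witness (v′ , q) → v ≡ v′
  witness-centre {v} {v′} {p} {q} eq = begin
    v                                                       ≡⟨ proj₂ (back v (root v p)) ⟩
    nbr (nbr v (root v p)) (proj₁ (back v (root v p)))      ≡⟨ cong (uncurry nbr) eq ⟩
    nbr (nbr v′ (root v′ q)) (proj₁ (back v′ (root v′ q)))  ≡⟨ proj₂ (back v′ (root v′ q)) ⟨
    v′                                                      ∎
    where open ≡-Reasoning

  witness-pair : m < 6 → ∀ {v p q} → witness (v , p) ≡ witness (v , q) → p ≡ q
  witness-pair m<6 {v} {p} {q} eq = begin
    p                                ≡⟨ proj₁ (proj₂ (choose v p)) ⟨
    pairIndex (root v p) (other v p) ≡⟨ cong₂ pairIndex same-root same-other ⟩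
    pairIndex (root v q) (other v q) ≡⟨ proj₁ (proj₂ (choose v q)) ⟩
    q                                ∎
    where
    open ≡-Reasoning
    same-root : root v p ≡ root v q
    same-root = nbr-injective v (cong proj₁ eq)
    same-other : other v p ≡ other v q
    same-other = decidable-stable (other v p ≟ other v q) λ o≢o′ → ℕ.<⇒≱ m<6
      (two-unseen⇒6≤m (o≢o′ ∘ colour-injective v) (proj₂ (proj₂ (choose v p)))
        (subst (λ d → ¬ Sees (nbr v d) (colour v (other v q))) (sym same-root) (proj₂ (proj₂ (choose v q)))))

  witness-injective : m < 6 → Injective _≡_ _≡_ witness
  witness-injective m<6 {v , p} {v′ , q} eq with refl ← witness-centre eq = cong (v ,_) (witness-pair m<6 eq)

star-colourable⇒6≤ : ∀ {G n} → FourRegular G → V G ↔ Fin n → .{{NonZero n}} →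
                     ∀ {m} → StarColourable G m → 6 ≤ m
star-colourable⇒6≤ {n = n} R V↔Fin {m} (c , star) with 6 ℕ.≤? m
... | yes 6≤m = 6≤m
... | no 6≰m = ⊥-elim (ℕ.<⇒≱ (ℕ.*-monoʳ-< n (ℕ.m<n+m 4 {2} ℕ.z<s))
                        (×-↣⇒≤ V↔Fin (mk↣ (LowerBound.witness-injective R c star (ℕ.≰⇒> 6≰m)))))

Alternating : ∀ {m} → Vec (Fin m) 4 → Set
Alternating (x₁ ∷ x₂ ∷ x₃ ∷ x₄ ∷ []) = x₁ ≡ x₃ × x₂ ≡ x₄

alternating? : ∀ {m} (xs : Vec (Fin m) 4) → Dec (Alternating xs)
alternating? (x₁ ∷ x₂ ∷ x₃ ∷ x₄ ∷ []) = x₁ ≟ x₃ ×-dec x₂ ≟ x₄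

same-side : ∀ {m} {x y z a b : Fin m} → x ≢ y → z ≢ y →
            x ≡ a ⊎ x ≡ b → y ≡ a ⊎ y ≡ b → z ≡ a ⊎ z ≡ b → x ≡ z
same-side x≢y _   (inj₁ refl) (inj₁ refl) _           = ⊥-elim (x≢y refl)
same-side x≢y _   (inj₂ refl) (inj₂ refl) _           = ⊥-elim (x≢y refl)
same-side _   z≢y _           (inj₁ refl) (inj₁ refl) = ⊥-elim (z≢y refl)
same-side _   z≢y _           (inj₂ refl) (inj₂ refl) = ⊥-elim (z≢y refl)
same-side _   _   (inj₁ refl) (inj₂ _)    (inj₁ refl) = refl
same-side _   _   (inj₂ refl) (inj₁ _)    (inj₂ refl) = refl

bichromatic⇒alternating : ∀ {m} {x₁ x₂ x₃ x₄ : Fin m} → x₁ ≢ x₂ → x₂ ≢ x₃ → x₃ ≢ x₄ →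
                          Bichromatic4 x₁ x₂ x₃ x₄ → Alternating (x₁ ∷ x₂ ∷ x₃ ∷ x₄ ∷ [])
bichromatic⇒alternating x₁≢x₂ x₂≢x₃ x₃≢x₄ (_ , _ , in₁ , in₂ , in₃ , in₄) =
  same-side x₁≢x₂ (x₂≢x₃ ∘ sym) in₁ in₂ in₃ , same-side x₂≢x₃ (x₃≢x₄ ∘ sym) in₂ in₃ in₄

Bichromatic4-cong : ∀ {m} {x₁ x₂ x₃ x₄ y₁ y₂ y₃ y₄ : Fin m} →
                    x₁ ≡ y₁ → x₂ ≡ y₂ → x₃ ≡ y₃ → x₄ ≡ y₄ →
                    Bichromatic4 x₁ x₂ x₃ x₄ → Bichromatic4 y₁ y₂ y₃ y₄
Bichromatic4-cong refl refl refl refl bi = bi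

walkColours : ∀ {S C : Set} {n} → (S → Fin 4 → S) → (S → Fin 4 → C) → S → Vec (Fin 4) n → Vec C n
walkColours step colour s []       = []
walkColours step colour s (d ∷ ds) = colour s d ∷ walkColours step colour (step s d) ds

module Directional {G : Graph} (R : FourRegular G) (_≟ᵥ_ : DecidableEquality (V G)) {m : ℕ}
                   (colour : V G → Fin 4 → Fin (suc m))
                   (colour-back : ∀ u d e → FourRegular.nbr R (FourRegular.nbr R u d) e ≡ u →
                                  colour (FourRegular.nbr R u d) e ≡ colour u d) where
  open FourRegular R

  edgeColour : V G → V G → Fin (suc m)
  edgeColour u v with any? (λ d → v ≟ᵥ nbr u d)
  ... | yes (d , _) = colour u d
  ... | no _        = zero    -- non-adjacent pairs: irrelevant

  edgeColour-nbr : ∀ u d → edgeColour u (nbr u d) ≡ colour u d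
  edgeColour-nbr u d with any? (λ d′ → nbr u d ≟ᵥ nbr u d′)
  ... | yes (d′ , eq) = cong (colour u) (sym (nbr-injective u eq))
  ... | no ∄d         = ⊥-elim (∄d (d , refl))

  edgeColour-sym : ∀ u v → Adj G u v → edgeColour u v ≡ edgeColour v u
  edgeColour-sym u _ uv with nbr-of-adj uv
  ... | d , refl with back u d
  ...   | e , u≡ = begin
    edgeColour u (nbr u d)                  ≡⟨ edgeColour-nbr u d ⟩
    colour u d                              ≡⟨ colour-back u d e (sym u≡) ⟨
    colour (nbr u d) e                      ≡⟨ edgeColour-nbr (nbr u d) e ⟨
    edgeColour (nbr u d) (nbr (nbr u d) e)  ≡⟨ cong (edgeColour (nbr u d)) u≡ ⟨
    edgeColour (nbr u d) u                  ∎
    where open ≡-Reasoning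

  colouring : EdgeColouring G (suc m)
  colouring = record { col = edgeColour ; sym = edgeColour-sym }

  NoAlternatingWalk : Set
  NoAlternatingWalk = ∀ v d₁ d₂ d₃ d₄ → let v₁ = nbr v d₁ ; v₂ = nbr v₁ d₂ ; v₃ = nbr v₂ d₃ in
    v₂ ≢ v → v₃ ≢ v₁ → nbr v₃ d₄ ≢ v₂ →
    ¬ Alternating (walkColours nbr colour v (d₁ ∷ d₂ ∷ d₃ ∷ d₄ ∷ []))

  module _ (colour-injective : ∀ v → Injective _≡_ _≡_ (colour v)) where

    proper : Proper colouring
    proper u _ _ uv uw v≢w eq with nbr-of-adj uv | nbr-of-adj uw
    ... | d , refl | d′ , refl = v≢w (cong (nbr u) (colour-injective u
      (trans (sym (edgeColour-nbr u d)) (trans eq (edgeColour-nbr u d′)))))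

    consecutive-colours-differ : ∀ v d d′ → nbr (nbr v d) d′ ≢ v → colour v d ≢ colour (nbr v d) d′
    consecutive-colours-differ v d d′ no-return eq with back v d
    ... | e , v≡ = no-return (trans (cong (nbr (nbr v d))
      (colour-injective (nbr v d) (trans (sym eq) (sym (colour-back v d e (sym v≡)))))) (sym v≡))

    bichromatic-walk-alternates : ∀ {v₀} d₁ d₂ d₃ d₄ →
      let v₁ = nbr v₀ d₁ ; v₂ = nbr v₁ d₂ ; v₃ = nbr v₂ d₃ in
      v₂ ≢ v₀ → v₃ ≢ v₁ → nbr v₃ d₄ ≢ v₂ →
      Bichromatic4 (colour v₀ d₁) (colour v₁ d₂) (colour v₂ d₃) (colour v₃ d₄) →
      Alternating (walkColours nbr colour v₀ (d₁ ∷ d₂ ∷ d₃ ∷ d₄ ∷ []))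
    bichromatic-walk-alternates {v₀} d₁ d₂ d₃ d₄ r₁ r₂ r₃ = bichromatic⇒alternating
      (consecutive-colours-differ v₀ d₁ d₂ r₁) (consecutive-colours-differ _ d₂ d₃ r₂)
      (consecutive-colours-differ _ d₃ d₄ r₃)

    ¬bichromaticPath : NoAlternatingWalk → ¬ BichromaticPath4 colouring
    ¬bichromaticPath naw
      (v₀ , _ , _ , _ , _ , (_ , n₀₂ , _ , _ , _ , n₁₃ , _ , _ , n₂₄ , _) , (a₁ , a₂ , a₃ , a₄) , bi)
      with nbr-of-adj a₁
    ... | d₁ , refl with nbr-of-adj a₂
    ... | d₂ , refl with nbr-of-adj a₃
    ... | d₃ , refl with nbr-of-adj a₄
    ... | d₄ , refl = naw v₀ d₁ d₂ d₃ d₄ (n₀₂ ∘ sym) (n₁₃ ∘ sym) (n₂₄ ∘ sym)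
      (bichromatic-walk-alternates d₁ d₂ d₃ d₄ (n₀₂ ∘ sym) (n₁₃ ∘ sym) (n₂₄ ∘ sym)
        (Bichromatic4-cong (edgeColour-nbr _ d₁) (edgeColour-nbr _ d₂) (edgeColour-nbr _ d₃)
          (edgeColour-nbr _ d₄) bi))

    ¬bichromaticCycle : NoAlternatingWalk → ¬ BichromaticCycle4 colouring
    ¬bichromaticCycle naw (v₀ , _ , _ , v₃ , (_ , n₀₂ , _ , _ , n₁₃ , _) , (a₁ , a₂ , a₃ , a₄) , bi)
      with nbr-of-adj a₁
    ... | d₁ , refl with nbr-of-adj a₂
    ... | d₂ , refl with nbr-of-adj a₃
    ... | d₃ , refl with nbr-of-adj a₄
    ... | d₄ , v₀≡ = naw v₀ d₁ d₂ d₃ d₄ (n₀₂ ∘ sym) (n₁₃ ∘ sym) (n₀₂ ∘ trans v₀≡)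
      (bichromatic-walk-alternates d₁ d₂ d₃ d₄ (n₀₂ ∘ sym) (n₁₃ ∘ sym) (n₀₂ ∘ trans v₀≡)
        (Bichromatic4-cong (edgeColour-nbr _ d₁) (edgeColour-nbr _ d₂) (edgeColour-nbr _ d₃)
          (trans (cong (edgeColour v₃) v₀≡) (edgeColour-nbr v₃ d₄)) bi))

    isStar : NoAlternatingWalk → IsStarEdgeColouring colouring
    isStar naw = proper , ¬bichromaticPath naw , ¬bichromaticCycle naw

-- The torus

pattern east  = 0F
pattern west  = 1F
pattern north = 2F
pattern south = 3F

opposite : Fin 4 → Fin 4
opposite east  = west
opposite west  = east
opposite north = south
opposite south = north

module Torus (a b : ℕ) where

  Grid : Graph
  Grid = Cycle (suc a) □ Cycle (suc b)

  nbr : V Grid → Fin 4 → V Grid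
  nbr (i , j) east  = next i , j
  nbr (i , j) west  = prev i , j
  nbr (i , j) north = i , next j
  nbr (i , j) south = i , prev j

  nbr-opposite : ∀ u d → nbr (nbr u d) (opposite d) ≡ u
  nbr-opposite (i , j) east  = cong (_, j) (prev-next i)
  nbr-opposite (i , j) west  = cong (_, j) (next-prev i)
  nbr-opposite (i , j) north = cong (i ,_) (prev-next j)
  nbr-opposite (i , j) south = cong (i ,_) (next-prev j)

  adj-nbr : ∀ u d → Adj Grid u (nbr u d)
  adj-nbr (i , j) east  = inj₁ (cycle-next i , refl)
  adj-nbr (i , j) west  = inj₁ (cycle-prev i , refl)
  adj-nbr (i , j) north = inj₂ (refl , cycle-next j)
  adj-nbr (i , j) south = inj₂ (refl , cycle-prev j)

  nbr-of-adj : ∀ {u v} → Adj Grid u v → ∃[ d ] v ≡ nbr u d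
  nbr-of-adj (inj₁ (ii′ , refl)) with cycle-adj ii′
  ... | inj₁ refl = east , refl
  ... | inj₂ refl = west , refl
  nbr-of-adj (inj₂ (refl , jj′)) with cycle-adj jj′
  ... | inj₁ refl = north , refl
  ... | inj₂ refl = south , refl

  adj-sym : Symmetric (Adj Grid)
  adj-sym (inj₁ (ii′ , refl)) = inj₁ (Sum.swap ii′ , refl)
  adj-sym (inj₂ (refl , jj′)) = inj₂ (refl , Sum.swap jj′)

  module _ (2≤a : 2 ≤ a) (2≤b : 2 ≤ b) where

    1≤a : 1 ≤ a
    1≤a = ℕ.<⇒≤ 2≤a

    nbr-injective : ∀ u → Injective _≡_ _≡_ (nbr u)
    nbr-injective u {east}  {east}  _ = refl
    nbr-injective u {west}  {west}  _ = refl
    nbr-injective u {north} {north} _ = refl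
    nbr-injective u {south} {south} _ = refl
    nbr-injective (i , j) {east}  {west}  p = ⊥-elim (next≢prev 2≤a {i} (cong proj₁ p))
    nbr-injective (i , j) {west}  {east}  p = ⊥-elim (next≢prev 2≤a {i} (cong proj₁ (sym p)))
    nbr-injective (i , j) {north} {south} p = ⊥-elim (next≢prev 2≤b {j} (cong proj₂ p))
    nbr-injective (i , j) {south} {north} p = ⊥-elim (next≢prev 2≤b {j} (cong proj₂ (sym p)))
    nbr-injective (i , j) {east}  {north} p = ⊥-elim (next≢ 1≤a {i} (cong proj₁ p))
    nbr-injective (i , j) {east}  {south} p = ⊥-elim (next≢ 1≤a {i} (cong proj₁ p))
    nbr-injective (i , j) {west}  {north} p = ⊥-elim (prev≢ 1≤a {i} (cong proj₁ p))
    nbr-injective (i , j) {west}  {south} p = ⊥-elim (prev≢ 1≤a {i} (cong proj₁ p))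
    nbr-injective (i , j) {north} {east}  p = ⊥-elim (next≢ 1≤a {i} (cong proj₁ (sym p)))
    nbr-injective (i , j) {south} {east}  p = ⊥-elim (next≢ 1≤a {i} (cong proj₁ (sym p)))
    nbr-injective (i , j) {north} {west}  p = ⊥-elim (prev≢ 1≤a {i} (cong proj₁ (sym p)))
    nbr-injective (i , j) {south} {west}  p = ⊥-elim (prev≢ 1≤a {i} (cong proj₁ (sym p)))

    adj-irrefl : ∀ {u} → ¬ Adj Grid u u
    adj-irrefl (inj₁ (ii , _)) = cycle-irrefl 1≤a ii
    adj-irrefl (inj₂ (_ , jj)) = cycle-irrefl (ℕ.<⇒≤ 2≤b) jj

    torus : FourRegular Grid
    torus = record
      { nbr = nbr ; adj-nbr = adj-nbr ; nbr-of-adj = nbr-of-adj ; nbr-injective = nbr-injective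
      ; adj-sym = adj-sym ; adj-irrefl = adj-irrefl }

    torus-star-colourable⇒6≤ : ∀ {m} → StarColourable Grid m → 6 ≤ m
    torus-star-colourable⇒6≤ = star-colourable⇒6≤ torus (↔-sym *↔×)

-- The colouring and its local check

ColumnType RowType : Set
ColumnType = Fin 4
RowType    = Fin 10

shifted : ℕ → ColumnType → Fin 6
shifted k c = (toℕ c + k) mod 4 ↑ˡ 2

parityColour : ℕ → ColumnType → Fin 6
parityColour k c = 4 ↑ʳ (toℕ c + k) mod 2

horizontal vertical : RowType → ColumnType → Fin 6
horizontal 0F = shifted 0
horizontal 1F = shifted 3
horizontal 2F = shifted 0
horizontal 3F = shifted 3
horizontal 4F = shifted 0
horizontal 5F = shifted 3
horizontal 6F = shifted 2
horizontal 7F = shifted 3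
horizontal 8F = shifted 2
horizontal 9F = shifted 1
vertical 0F = shifted 1
vertical 1F = parityColour 0
vertical 2F = shifted 1
vertical 3F = parityColour 1
vertical 4F = shifted 1
vertical 5F = parityColour 0
vertical 6F = shifted 0
vertical 7F = parityColour 0
vertical 8F = shifted 3
vertical 9F = parityColour 1

successors : RowType → List RowType
successors 0F = 1F ∷ []
successors 1F = 2F ∷ []
successors 2F = 3F ∷ []
successors 3F = 0F ∷ 4F ∷ []
successors 4F = 5F ∷ []
successors 5F = 6F ∷ []
successors 6F = 7F ∷ []
successors 7F = 8F ∷ []
successors 8F = 9F ∷ []
successors 9F = 0F ∷ 4F ∷ []

Step : RowType → RowType → Set
Step r s = s ∈ successors r

Window : Set
Window = Vec RowType 9

-- Positions beyond the end read the junk type 0F; the walks simulated below never get there.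
rowAt : ∀ {n} → Vec RowType n → ℕ → RowType
rowAt []       _       = 0F
rowAt (r ∷ _)  zero    = r
rowAt (_ ∷ rs) (suc y) = rowAt rs y

rowAt-tabulate : ∀ {n} (f : ℕ → RowType) y → y < n → rowAt (tabulate {n = n} (f ∘ toℕ)) y ≡ f y
rowAt-tabulate f zero    (s≤s _)   = refl
rowAt-tabulate f (suc y) (s≤s y<n) = rowAt-tabulate (f ∘ suc) y y<n

Position : Set
Position = ColumnType × ℕ

localColour : Window → Position → Fin 4 → Fin 6
localColour w (c , y) east  = horizontal (rowAt w y) c
localColour w (c , y) west  = horizontal (rowAt w y) (prev c)
localColour w (c , y) north = vertical (rowAt w y) c
localColour w (c , y) south = vertical (rowAt w (ℕ.pred y)) c

move : Position → Fin 4 → Position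
move (c , y) east  = next c , y
move (c , y) west  = prev c , y
move (c , y) north = c , suc y
move (c , y) south = c , ℕ.pred y

LocallyStar : Window → Set
LocallyStar w = ∀ c → Injective _≡_ _≡_ (localColour w (c , 4)) ×
  (∀ d₁ d₂ d₃ d₄ → d₂ ≢ opposite d₁ → d₃ ≢ opposite d₂ → d₄ ≢ opposite d₃ →
     ¬ Alternating (walkColours move (localColour w) (c , 4) (d₁ ∷ d₂ ∷ d₃ ∷ d₄ ∷ [])))

AllChains : ∀ n → RowType → (Vec RowType (suc n) → Set) → Set
AllChains zero    r P = P (r ∷ [])
AllChains (suc n) r P = ∀ s → Step r s → AllChains n s (P ∘ (r ∷_))

allChains-tabulate : ∀ {n} {P : Vec RowType (suc n) → Set} (f : ℕ → RowType) →
                     (∀ t → Step (f t) (f (suc t))) →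
                     AllChains n (f 0) P → P (tabulate (f ∘ toℕ))
allChains-tabulate {zero}  f steps h = h
allChains-tabulate {suc n} {P} f steps h =
  allChains-tabulate {P = P ∘ (f 0 ∷_)} (f ∘ suc) (steps ∘ suc) (h (f 1) (steps 0))

allChains? : ∀ {n} {P : Vec RowType (suc n) → Set} → (∀ rs → Dec (P rs)) → ∀ r → Dec (AllChains n r P)
allChains? {zero}  P? r = P? (r ∷ [])
allChains? {suc n} P? r = all? λ s → s ∈? successors r →-dec allChains? (P? ∘ (r ∷_)) s

injective? : ∀ {n m} (f : Fin n → Fin m) → Dec (Injective _≡_ _≡_ f)
injective? f = map′ (λ h {x} {y} → h x y) (λ h x y → h) (all? λ x → all? λ y → f x ≟ f y →-dec x ≟ y)

locallyStar? : ∀ w → Dec (LocallyStar w)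
locallyStar? w = all? λ c → injective? (localColour w (c , 4)) ×-dec
  (all? λ d₁ → all? λ d₂ → all? λ d₃ → all? λ d₄ →
    ¬? (d₂ ≟ _) →-dec ¬? (d₃ ≟ _) →-dec ¬? (d₄ ≟ _) →-dec ¬? (alternating? _))

localCheck : ∀ r → AllChains 8 r LocallyStar
localCheck = from-yes (all? (allChains? locallyStar?))

module TorusColouring {a b : ℕ} (2≤a : 2 ≤ a) (2≤b : 2 ≤ b)
             (column : Fin (suc a) → ColumnType) (column-next : ∀ i → column (next i) ≡ next (column i))
             (row : Fin (suc b) → RowType) (row-next : ∀ j → Step (row j) (row (next j))) where
  open Torus a b

  column-prev : ∀ i → column (prev i) ≡ prev (column i)
  column-prev i = begin
    column (prev i)               ≡⟨ prev-next (column (prev i)) ⟨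
    prev (next (column (prev i))) ≡⟨ cong prev (column-next (prev i)) ⟨
    prev (column (next (prev i))) ≡⟨ cong (prev ∘ column) (next-prev i) ⟩
    prev (column i)               ∎
    where open ≡-Reasoning

  colour : V Grid → Fin 4 → Fin 6
  colour (i , j) east  = horizontal (row j) (column i)
  colour (i , j) west  = horizontal (row j) (column (prev i))
  colour (i , j) north = vertical (row j) (column i)
  colour (i , j) south = vertical (row (prev j)) (column i)

  colour-back : ∀ u d e → nbr (nbr u d) e ≡ u → colour (nbr u d) e ≡ colour u d
  colour-back u d e eq with nbr-injective 2≤a 2≤b (nbr u d) (trans eq (sym (nbr-opposite u d)))
  colour-back (i , j) east  _ _ | refl = cong (λ i′ → horizontal (row j) (column i′)) (prev-next i)
  colour-back (i , j) west  _ _ | refl = refl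
  colour-back (i , j) north _ _ | refl = cong (λ j′ → vertical (row j′) (column i)) (prev-next j)
  colour-back (i , j) south _ _ | refl = refl

  window : Fin (suc b) → Window
  window j₀ = tabulate λ t → row (next^ (toℕ t) j₀)

  base : Fin (suc b) → Fin (suc b)
  base j = prev (prev (prev (prev j)))

  next^4-base : ∀ j → next^ 4 (base j) ≡ j
  next^4-base j = begin
    next (next (next (next (prev (prev (prev (prev j)))))))
      ≡⟨ cong (next ∘ next ∘ next) (next-prev (prev (prev (prev j)))) ⟩
    next (next (next (prev (prev (prev j)))))
      ≡⟨ cong (next ∘ next) (next-prev (prev (prev j))) ⟩
    next (next (prev (prev j)))
      ≡⟨ cong next (next-prev (prev j)) ⟩
    next (prev j)
      ≡⟨ next-prev j ⟩
    j ∎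
    where open ≡-Reasoning

  Within : ℕ → ℕ → Set
  Within r y = r ≤ y × y + r ≤ 8

  -- v sits at position p of the window starting at row j₀, and r more steps of the walk stay inside it.
  At : Fin (suc b) → V Grid → Position → ℕ → Set
  At j₀ (i , j) (c , y) r = column i ≡ c × j ≡ next^ y j₀ × Within r y

  within-stay : ∀ {r y} → Within (suc r) y → Within r y
  within-stay {r} {y} (r<y , bound) = ℕ.<⇒≤ r<y , ℕ.≤-trans (ℕ.+-monoʳ-≤ y (ℕ.n≤1+n r)) bound

  within-up : ∀ {r y} → Within (suc r) y → Within r (suc y)
  within-up {r} {y} (r<y , bound) = ℕ.≤-trans (ℕ.<⇒≤ r<y) (ℕ.n≤1+n y) , subst (_≤ 8) (ℕ.+-suc y r) bound

  within-down : ∀ {r y} → Within (suc r) (suc y) → Within r y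
  within-down {r} {y} (s≤s r≤y , bound) =
    r≤y , ℕ.≤-trans (ℕ.n≤1+n (y + r)) (proj₂ (within-stay (s≤s r≤y , bound)))

  row-window : ∀ {j₀ r y} → Within r y → rowAt (window j₀) y ≡ row (next^ y j₀)
  row-window {j₀} {r} {y} (_ , bound) =
    rowAt-tabulate (λ t → row (next^ t j₀)) y (s≤s (ℕ.≤-trans (ℕ.m≤m+n y r) bound))

  colour-step : ∀ {j₀ v p r} d → At j₀ v p (suc r) → colour v d ≡ localColour (window j₀) p d
  colour-step {v = i , _} east  (refl , refl , w) = cong (λ r → horizontal r (column i)) (sym (row-window w))
  colour-step {v = i , _} west  (refl , refl , w) = cong₂ horizontal (sym (row-window w)) (column-prev i)
  colour-step {v = i , _} north (refl , refl , w) = cong (λ r → vertical r (column i)) (sym (row-window w))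
  colour-step {j₀} {i , _} {_ , suc y} south (refl , refl , w) =
    cong (λ r → vertical r (column i)) (trans (cong row (prev-next (next^ y j₀))) (sym (row-window (within-down w))))

  at-step : ∀ {j₀ v p r} d → At j₀ v p (suc r) → At j₀ (nbr v d) (move p d) r
  at-step {v = i , _} east  (refl , refl , w) = column-next i , refl , within-stay w
  at-step {v = i , _} west  (refl , refl , w) = column-prev i , refl , within-stay w
  at-step north (refl , refl , w) = refl , refl , within-up w
  at-step {j₀} {p = _ , suc y} south (refl , refl , w) = refl , prev-next (next^ y j₀) , within-down w

  simulate : ∀ {j₀ v p n} → At j₀ v p n → (ds : Vec (Fin 4) n) →
             walkColours nbr colour v ds ≡ walkColours move (localColour (window j₀)) p ds
  simulate at []       = refl
  simulate at (d ∷ ds) = cong₂ _∷_ (colour-step d at) (simulate (at-step d at) ds)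

  centre : ∀ i j → At (base j) (i , j) (column i , 4) 4
  centre i j = refl , sym (next^4-base j) , ℕ.≤-refl , ℕ.≤-refl

  window-star : ∀ j → LocallyStar (window (base j))
  window-star j = allChains-tabulate {P = LocallyStar}
    (λ t → row (next^ t (base j))) (λ t → row-next (next^ t (base j))) (localCheck (row (base j)))

  colour-injective : ∀ v → Injective _≡_ _≡_ (colour v)
  colour-injective (i , j) {d} {d′} eq = proj₁ (window-star j (column i))
    (trans (sym (colour-step d (centre i j))) (trans eq (colour-step d′ (centre i j))))

  ¬return⇒≢opposite : ∀ {v d d′} → nbr (nbr v d) d′ ≢ v → d′ ≢ opposite d
  ¬return⇒≢opposite {v} {d} nb refl = nb (nbr-opposite v d)

  open Directional (torus 2≤a 2≤b) (≡-dec _≟_ _≟_) colour colour-back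

  no-alternating-walk : NoAlternatingWalk
  no-alternating-walk (i , j) d₁ d₂ d₃ d₄ nb₁ nb₂ nb₃ alt =
    proj₂ (window-star j (column i)) d₁ d₂ d₃ d₄
      (¬return⇒≢opposite nb₁) (¬return⇒≢opposite nb₂) (¬return⇒≢opposite nb₃)
      (subst Alternating (simulate (centre i j) (d₁ ∷ d₂ ∷ d₃ ∷ d₄ ∷ [])) alt)

  star-colourable : StarColourable Grid 6
  star-colourable = colouring , isStar colour-injective no-alternating-walk

fourBlock : ℕ → RowType
fourBlock t = t mod 4 ↑ˡ 6

fourBlock-step : ∀ t → Step (fourBlock t) (fourBlock (suc t))
fourBlock-step t = subst (λ (c : ColumnType) → Step (fourBlock t) (c ↑ˡ 6)) (next-mod {3} t) (within (t mod 4))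
  where
  within : ∀ c → Step (c ↑ˡ 6) (next c ↑ˡ 6)
  within 0F = here refl
  within 1F = here refl
  within 2F = here refl
  within 3F = here refl

fourBlock-wrap : ∀ b q → suc b ≡ 4 * suc q → Step (fourBlock b) (fourBlock 0)
fourBlock-wrap b q e = subst (λ c → Step (c ↑ˡ 6) 0F) (sym (last-residue 3 b (suc q) e)) (here refl)

sixThenFour : ℕ → RowType
sixThenFour 0 = 4F
sixThenFour 1 = 5F
sixThenFour 2 = 6F
sixThenFour 3 = 7F
sixThenFour 4 = 8F
sixThenFour 5 = 9F
sixThenFour (suc (suc (suc (suc (suc (suc t)))))) = fourBlock t

sixThenFour-step : ∀ t → Step (sixThenFour t) (sixThenFour (suc t))
sixThenFour-step 0 = here refl
sixThenFour-step 1 = here refl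
sixThenFour-step 2 = here refl
sixThenFour-step 3 = here refl
sixThenFour-step 4 = here refl
sixThenFour-step 5 = here refl
sixThenFour-step (suc (suc (suc (suc (suc (suc t)))))) = fourBlock-step t

sixThenFour-wrap : ∀ b q → suc b ≡ 6 + 4 * q → Step (sixThenFour b) (sixThenFour 0)
sixThenFour-wrap _ zero    refl = there (here refl)
sixThenFour-wrap _ (suc q) refl =
  subst (λ c → Step (c ↑ˡ 6) 4F) (sym (last-residue 3 _ (suc q) refl)) (there (here refl))

four-more : ∀ l → 2 * (4 + l) ≡ 4 + 2 * (2 + l)
four-more l = ℕ.*-distribˡ-+ 2 2 (2 + l)

twice-cases : ∀ l → (∃[ q ] 2 * (2 + l) ≡ 4 * suc q) ⊎ (∃[ q ] 2 * (2 + l) ≡ 6 + 4 * q)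
twice-cases zero          = inj₁ (0 , refl)
twice-cases (suc zero)    = inj₂ (0 , refl)
twice-cases (suc (suc l)) with twice-cases l
... | inj₁ (q , e) = inj₁ (suc q , trans (four-more l) (trans (cong (4 +_) e) (sym (ℕ.*-suc 4 (suc q)))))
... | inj₂ (q , e) = inj₂ (suc q , trans (four-more l) (trans (cong (4 +_) e) (cong (6 +_) (sym (ℕ.*-suc 4 q)))))

rows : ∀ l → Σ[ row ∈ (Fin (2 * (2 + l)) → RowType) ] ∀ j → Step (row j) (row (next j))
rows l with twice-cases l
... | inj₁ (q , e) = fourBlock ∘ toℕ , cyclic-closure Step fourBlock fourBlock-step (fourBlock-wrap _ q e)
... | inj₂ (q , e) = sixThenFour ∘ toℕ , cyclic-closure Step sixThenFour sixThenFour-step (sixThenFour-wrap _ q e)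

columns : ∀ k → Σ[ column ∈ (Fin (4 * suc k) → ColumnType) ] ∀ i → column (next i) ≡ next (column i)
columns k = (λ i → toℕ i mod 4) , cyclic-closure (λ x y → y ≡ next x) (_mod 4) (λ t → sym (next-mod t)) wrap
  where
  wrap : 0 mod 4 ≡ next (ℕ.pred (4 * suc k) mod 4)
  wrap = sym (cong next (last-residue 3 _ (suc k) refl))

theorem13 : (k ℓ : ℕ) → 1 ≤ k → 2 ≤ ℓ →
    StarChromaticIndex≡ (Cycle (4 * k) □ Cycle (2 * ℓ)) 6
theorem13 zero _ () _
theorem13 (suc k) (suc zero) _ (s≤s ())
theorem13 (suc k) (suc (suc l)) _ _ =
  TorusColouring.star-colourable 2≤a 2≤b (proj₁ (columns k)) (proj₂ (columns k)) (proj₁ (rows l)) (proj₂ (rows l))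
  ,
  λ _ → Torus.torus-star-colourable⇒6≤ _ _ 2≤a 2≤b
  where
  2≤a : 2 ≤ ℕ.pred (4 * suc k)
  2≤a = ℕ.<⇒≤ (ℕ.pred-mono-≤ (ℕ.m≤m*n 4 (suc k)))
  2≤b : 2 ≤ ℕ.pred (2 * (2 + l))
  2≤b = ℕ.<⇒≤ (ℕ.pred-mono-≤ (ℕ.*-monoʳ-≤ 2 {2} {2 + l} (s≤s (s≤s ℕ.z≤n))))
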